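{- Let $S$ be a lattice of finite length, let $(L_x)_{x\in S}$ be lattices of finite length, and let $(\phi_{yx})_{x\le y}$ be partial maps forming an $S$-connected system. Let $x,y\in S$, $a\in L_x$ and $b\in L_y$. The following are equivalent: (i) there is $z\in S$ with $z\ge x$ and $z\ge y$ such that $\phi_{zx}(a)$ and $\phi_{zy}(b)$ are both defined and $\phi_{zx}(a)=\phi_{zy}(b)$; (ii) $\phi_{(x\vee y)x}(a)$ and $\phi_{(x\vee y)y}(b)$ are both defined and equal; (iii) there is $z\in S$ with $z\le x$ and $z\le y$ such that $a\in\operatorname{im}\phi_{xz}$, $b\in\operatorname{im}\phi_{yz}$ and $\phi_{xz}^{ -1}(a)=\phi_{yz}^{ -1}(b)$; (iv) $a\in\operatorname{im}\phi_{x(x\wedge y)}$, $b\in\operatorname{im}\phi_{y(x\wedge y)}$ and $\phi_{x(x\wedge y)}^{ -1}(a)=\phi_{y(x\wedge y)}^{ -1}(b)$.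
   Context: A partially ordered set is of finite length if every chain in it is finite. $S$ has order $\le$, join $\vee$ and meet $\wedge$, and $x\prec y$ means $y$ covers $x$. The sets $L_x$ are regarded as pairwise disjoint. Partial maps: for $x\le y$, $\phi_{yx}$ is a partial map $L_x\to L_y$ that is a bijection from $\operatorname{dom}\phi_{yx}$ onto $\operatorname{im}\phi_{yx}$; it may be empty. Partial maps compose: $(\psi\circ\phi)(a)$ is defined iff $\phi(a)$ is defined and $\psi$ is defined at $\phi(a)$. The system is $S$-connected if for all $x,y\in S$: (17) if $x\le y$ and $\phi_{yx}\ne\emptyset$, then $\phi_{yx}$ is a lattice isomorphism from a filter of $L_x$ onto an ideal of $L_y$, and $\phi_{xx}=\mathrm{id}_{L_x}$; (18) $x\prec y$ implies $\phi_{yx}\ne\emptyset$; (19) $x\le z\le y$ implies $\phi_{yx}=\phi_{yz}\circ\phi_{zx}$; (20) $\operatorname{im}\phi_{(x\vee y)x}\cap\operatorname{im}\phi_{(x\vee y)y}\subseteq\operatorname{im}\phi_{(x\vee y)(x\wedge y)}$; (20$^\delta$) $\operatorname{dom}\phi_{x(x\wedge y)}\cap\operatorname{dom}\phi_{y(x\wedge y)}\subseteq\operatorname{dom}\phi_{(x\vee y)(x\wedge y)}$. A filter is a nonempty up-closed subset closed under meets; an ideal is the dual notion. -}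

module Defs where

open import Level using (0ℓ)
open import Data.Product using (Σ; ∃; _×_; _,_)
open import Data.Sum using (_⊎_)
open import Data.Maybe using (Maybe; just; nothing; _>>=_)
open import Data.List using (List)
open import Data.List.Membership.Propositional using (_∈_)
open import Relation.Nullary using (¬_)
open import Relation.Binary.Core using (Rel)
open import Relation.Binary.PropositionalEquality using (_≡_)
open import Algebra.Core using (Op₂)
open import Relation.Binary.Lattice.Structures using (IsLattice)

record Lat : Set₁ where
  field
    Carrier : Set
    _≤_ : Rel Carrier 0ℓ
    _∨_ : Op₂ Carrier
    _∧_ : Op₂ Carrier
    isLattice : IsLattice _≡_ _≤_ _∨_ _∧_

IsChain : (L : Lat) → (Lat.Carrier L → Set) → Set
IsChain L C = ∀ a b → C a → C b → (a ≤ b) ⊎ (b ≤ a)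
  where open Lat L

IsFiniteSubset : {A : Set} → (A → Set) → Set
IsFiniteSubset {A} C = Σ (List A) λ xs → ∀ a → C a → a ∈ xs

FiniteLength : Lat → Set₁
FiniteLength L = ∀ (C : Lat.Carrier L → Set) → IsChain L C → IsFiniteSubset C

IsFilter : (L : Lat) → (Lat.Carrier L → Set) → Set
IsFilter L F =
  (Σ Carrier F) ×
  (∀ a b → F a → a ≤ b → F b) ×
  (∀ a b → F a → F b → F (a ∧ b))
  where open Lat L

IsIdeal : (L : Lat) → (Lat.Carrier L → Set) → Set
IsIdeal L I =
  (Σ Carrier I) ×
  (∀ a b → I b → a ≤ b → I a) ×
  (∀ a b → I a → I b → I (a ∨ b))
  where open Lat L

-- Partial maps A ⇀ B are modelled as functions A → Maybe B.
Dom : {A B : Set} → (A → Maybe B) → A → Set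
Dom f a = Σ _ λ b → f a ≡ just b

Im : {A B : Set} → (A → Maybe B) → B → Set
Im f b = Σ _ λ a → f a ≡ just b

Nonempty : {A B : Set} → (A → Maybe B) → Set
Nonempty f = Σ _ λ a → Dom f a

PInjective : {A B : Set} → (A → Maybe B) → Set
PInjective f = ∀ a a' b → f a ≡ just b → f a' ≡ just b → a ≡ a'

IsFilterIdealIso : (K L : Lat) → (Lat.Carrier K → Maybe (Lat.Carrier L)) → Set
IsFilterIdealIso K L f =
  IsFilter K (Dom f) × IsIdeal L (Im f) × PInjective f ×
  (∀ a a' b b' → f a ≡ just b → f a' ≡ just b' →
     f (Lat._∧_ K a a') ≡ just (Lat._∧_ L b b')) ×
  (∀ a a' b b' → f a ≡ just b → f a' ≡ just b' →
     f (Lat._∨_ K a a') ≡ just (Lat._∨_ L b b'))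

-- A system over S: lattices L x for x ∈ S and partial maps φ y x : L x ⇀ L y
-- (only meaningful when x ≤ y; values for x ≰ y are irrelevant).
record System (S : Lat) : Set₁ where
  open Lat S
  field
    L : Carrier → Lat
    φ : (y x : Carrier) → Lat.Carrier (L x) → Maybe (Lat.Carrier (L y))

Covers : (S : Lat) → Lat.Carrier S → Lat.Carrier S → Set
Covers S x y = (x ≤ y) × ¬ (x ≡ y) × (∀ z → x ≤ z → z ≤ y → (z ≡ x) ⊎ (z ≡ y))
  where open Lat S

-- S-connectedness, conditions (17)-(20δ), plus the standing requirement that
-- each φ y x (x ≤ y) is a bijection from its domain onto its image.
record SConnected (S : Lat) (Sys : System S) : Set where
  open Lat S
  open System Sys
  field
    bij   : ∀ x y → x ≤ y → PInjective (φ y x)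
    c17   : ∀ x y → x ≤ y → Nonempty (φ y x) → IsFilterIdealIso (L x) (L y) (φ y x)
    c17id : ∀ x a → φ x x a ≡ just a
    c18   : ∀ x y → Covers S x y → Nonempty (φ y x)
    c19   : ∀ x z y → x ≤ z → z ≤ y → ∀ a → φ y x a ≡ (φ z x a >>= φ y z)
    c20   : ∀ x y c → Im (φ (x ∨ y) x) c → Im (φ (x ∨ y) y) c →
              Im (φ (x ∨ y) (x ∧ y)) c
    c20δ  : ∀ x y d → Dom (φ x (x ∧ y)) d → Dom (φ y (x ∧ y)) d →
              Dom (φ (x ∨ y) (x ∧ y)) d

{-# OPTIONS --safe #-}
-- By (19) every φ z x with x ≤ z factors through any w between x and z, and
-- injectivity of φ z w lets agreement of images in L z descend to L w; dually a
-- common preimage in L z ascends to any w between z and x, y.  This gives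
-- (i) ⇒ (ii) and (iii) ⇒ (iv), with the converses witnessed by z = x ∨ y and
-- z = x ∧ y.  Finally (20) turns a common image in L (x ∨ y) into a common
-- preimage in L (x ∧ y), and (20δ) turns it back.
module Submission where

open import Defs
open import Data.Product using (Σ; _×_; _,_)
open import Data.Maybe using (Maybe; just; _>>=_)
open import Data.Maybe.Properties using (just-injective)
open import Relation.Binary.PropositionalEquality using (_≡_; refl; sym; trans)
open import Function.Bundles using (_⇔_; mk⇔)
open import Function.Construct.Composition using (_⇔-∘_)
open import Function.Construct.Symmetry using (⇔-sym)
open import Relation.Binary.Lattice.Structures using (IsLattice)

>>=-just-inv : {A B : Set} (m : Maybe A) (f : A → Maybe B) {c : B} →
  (m >>= f) ≡ just c → Σ A λ a → m ≡ just a × f a ≡ just c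
>>=-just-inv (just a) f eq = a , refl , eq

module SConnectedProperties {S : Lat} {Sys : System S} (sc : SConnected S Sys) where
  open Lat S
  open IsLattice isLattice using (x≤x∨y; y≤x∨y; ∨-least; x∧y≤x; x∧y≤y; ∧-greatest)
  open System Sys
  open SConnected sc

  ⟦_⟧ : Carrier → Set
  ⟦ x ⟧ = Lat.Carrier (L x)

  CommonImageIn : (z : Carrier) {x y : Carrier} → ⟦ x ⟧ → ⟦ y ⟧ → Set
  CommonImageIn z {x} {y} a b = Σ ⟦ z ⟧ λ c → φ z x a ≡ just c × φ z y b ≡ just c

  CommonPreimageIn : (z : Carrier) {x y : Carrier} → ⟦ x ⟧ → ⟦ y ⟧ → Set
  CommonPreimageIn z {x} {y} a b = Σ ⟦ z ⟧ λ d → φ x z d ≡ just a × φ y z d ≡ just b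

  φ-split : ∀ {x z y} → x ≤ z → z ≤ y → ∀ {a c} → φ y x a ≡ just c →
    Σ ⟦ z ⟧ λ b → φ z x a ≡ just b × φ y z b ≡ just c
  φ-split x≤z z≤y {a} eq =
    >>=-just-inv (φ _ _ a) (φ _ _) (trans (sym (c19 _ _ _ x≤z z≤y a)) eq)

  φ-split-at : ∀ {x z y} → x ≤ z → z ≤ y → ∀ {a b c} →
    φ z x a ≡ just b → φ y x a ≡ just c → φ y z b ≡ just c
  φ-split-at x≤z z≤y eqb eqc with φ-split x≤z z≤y eqc
  ... | b′ , eqb′ , eq with just-injective (trans (sym eqb) eqb′)
  ... | refl = eq

  φ-cancelˡ : ∀ {x z y} → x ≤ z → z ≤ y → ∀ {a d c} →
    φ y z a ≡ just c → φ y x d ≡ just c → φ z x d ≡ just a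
  φ-cancelˡ x≤z z≤y eqa eqd with φ-split x≤z z≤y eqd
  ... | a′ , eqa′ , eq with bij _ _ z≤y a′ _ _ eq eqa
  ... | refl = eqa′

  commonImage-descends : ∀ {x y w z} → x ≤ w → y ≤ w → w ≤ z →
    ∀ {a : ⟦ x ⟧} {b : ⟦ y ⟧} → CommonImageIn z a b → CommonImageIn w a b
  commonImage-descends x≤w y≤w w≤z (c , eqa , eqb) with φ-split x≤w w≤z eqa
  ... | c′ , eqa′ , eq = c′ , eqa′ , φ-cancelˡ y≤w w≤z eq eqb

  commonPreimage-ascends : ∀ {x y w z} → z ≤ w → w ≤ x → w ≤ y →
    ∀ {a : ⟦ x ⟧} {b : ⟦ y ⟧} → CommonPreimageIn z a b → CommonPreimageIn w a b
  commonPreimage-ascends z≤w w≤x w≤y (d , eqa , eqb) with φ-split z≤w w≤x eqa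
  ... | e , eqe , eq = e , eq , φ-split-at z≤w w≤y eqe eqb

  commonImage-join⇒commonPreimage-meet : ∀ {x y} {a : ⟦ x ⟧} {b : ⟦ y ⟧} →
    CommonImageIn (x ∨ y) a b → CommonPreimageIn (x ∧ y) a b
  commonImage-join⇒commonPreimage-meet {x} {y} {a} {b} (c , eqa , eqb)
    with c20 x y c (a , eqa) (b , eqb)
  ... | d , eqd = d , φ-cancelˡ (x∧y≤x x y) (x≤x∨y x y) eqa eqd
                    , φ-cancelˡ (x∧y≤y x y) (y≤x∨y x y) eqb eqd

  commonPreimage-meet⇒commonImage-join : ∀ {x y} {a : ⟦ x ⟧} {b : ⟦ y ⟧} →
    CommonPreimageIn (x ∧ y) a b → CommonImageIn (x ∨ y) a b
  commonPreimage-meet⇒commonImage-join {x} {y} {a} {b} (d , eqa , eqb)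
    with c20δ x y d (a , eqa) (b , eqb)
  ... | c , eqc = c , φ-split-at (x∧y≤x x y) (x≤x∨y x y) eqa eqc
                    , φ-split-at (x∧y≤y x y) (y≤x∨y x y) eqb eqc

  commonImage-join⇔commonPreimage-meet : ∀ {x y} {a : ⟦ x ⟧} {b : ⟦ y ⟧} →
    CommonImageIn (x ∨ y) a b ⇔ CommonPreimageIn (x ∧ y) a b
  commonImage-join⇔commonPreimage-meet =
    mk⇔ commonImage-join⇒commonPreimage-meet commonPreimage-meet⇒commonImage-join

  commonImage-upper⇔join : ∀ {x y} {a : ⟦ x ⟧} {b : ⟦ y ⟧} →
    (Σ Carrier λ z → x ≤ z × y ≤ z × CommonImageIn z a b) ⇔ CommonImageIn (x ∨ y) a b
  commonImage-upper⇔join {x} {y} = mk⇔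
    (λ (z , x≤z , y≤z , common) →
      commonImage-descends (x≤x∨y x y) (y≤x∨y x y) (∨-least x≤z y≤z) common)
    (λ common → x ∨ y , x≤x∨y x y , y≤x∨y x y , common)

  commonPreimage-lower⇔meet : ∀ {x y} {a : ⟦ x ⟧} {b : ⟦ y ⟧} →
    (Σ Carrier λ z → z ≤ x × z ≤ y × CommonPreimageIn z a b) ⇔ CommonPreimageIn (x ∧ y) a b
  commonPreimage-lower⇔meet {x} {y} = mk⇔
    (λ (z , z≤x , z≤y , common) →
      commonPreimage-ascends (∧-greatest z≤x z≤y) (x∧y≤x x y) (x∧y≤y x y) common)
    (λ common → x ∧ y , x∧y≤x x y , x∧y≤y x y , common)

proposition4p1 : (S : Lat) → FiniteLength S → (Sys : System S) →
    (∀ x → FiniteLength (System.L Sys x)) → SConnected S Sys →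
    ∀ x y (a : Lat.Carrier (System.L Sys x)) (b : Lat.Carrier (System.L Sys y)) →
    let open Lat S
        open System Sys
        i = Σ Carrier λ z → x ≤ z × y ≤ z × Σ (Lat.Carrier (L z)) λ c → φ z x a ≡ just c × φ z y b ≡ just c
        ii = Σ (Lat.Carrier (L (x ∨ y))) λ c → φ (x ∨ y) x a ≡ just c × φ (x ∨ y) y b ≡ just c
        iii = Σ Carrier λ z → z ≤ x × z ≤ y × Σ (Lat.Carrier (L z)) λ d → φ x z d ≡ just a × φ y z d ≡ just b
        iv = Σ (Lat.Carrier (L (x ∧ y))) λ d → φ x (x ∧ y) d ≡ just a × φ y (x ∧ y) d ≡ just b
    in (i ⇔ ii) × (ii ⇔ iii) × (iii ⇔ iv)
proposition4p1 S _ Sys _ sc x y a b =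
  commonImage-upper⇔join ,
  ⇔-sym commonPreimage-lower⇔meet ⇔-∘ commonImage-join⇔commonPreimage-meet ,
  commonPreimage-lower⇔meet
  where open SConnectedProperties sc
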